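{- Let $\mathcal{F}$ be a $3$-uniform minimal odd-sunflower in which no element is contained in all sets of $\mathcal{F}$. Then every element contained in more than one set of $\mathcal{F}$ is contained in exactly $3$ sets of $\mathcal{F}$.
   Context: A family of at least two nonempty sets is an odd-sunflower if every element of the underlying set is contained in an odd number of its sets, or in none. An odd-sunflower is minimal if no proper subfamily of it is an odd-sunflower. -}

module Defs where

open import Data.Nat using (ℕ; _≤_; _%_)
open import Data.Fin using (Fin)
open import Data.Fin.Subset using (Subset; _∈_; _∩_; ∣_∣; Nonempty; _⊂_; ⊤)
open import Data.Vec using (tabulate; lookup)
open import Data.Sum using (_⊎_)
open import Data.Product using (_×_)
open import Relation.Binary.PropositionalEquality using (_≡_)
open import Relation.Nullary using (¬_)

-- A finite family of m subsets of the ground set Fin n is F : Fin m → Subset n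
-- (distinctness of the members is imposed separately where needed).
-- A subfamily is given by a set of indices I : Subset m.

Odd : ℕ → Set
Odd k = k % 2 ≡ 1

containing : ∀ {m n} → (Fin m → Subset n) → Fin n → Subset m
containing F x = tabulate (λ i → lookup (F i) x)

degIn : ∀ {m n} → (Fin m → Subset n) → Subset m → Fin n → ℕ
degIn F I x = ∣ I ∩ containing F x ∣

deg : ∀ {m n} → (Fin m → Subset n) → Fin n → ℕ
deg F x = degIn F ⊤ x

IsOddSunflowerIn : ∀ {m n} → (Fin m → Subset n) → Subset m → Set
IsOddSunflowerIn {m} {n} F I =
  (2 ≤ ∣ I ∣) ×
  ((i : Fin m) → i ∈ I → Nonempty (F i)) ×
  ((x : Fin n) → degIn F I x ≡ 0 ⊎ Odd (degIn F I x))

IsOddSunflower : ∀ {m n} → (Fin m → Subset n) → Set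
IsOddSunflower F = IsOddSunflowerIn F ⊤

IsMinimalOddSunflower : ∀ {m n} → (Fin m → Subset n) → Set
IsMinimalOddSunflower {m} F =
  IsOddSunflower F × ((I : Subset m) → I ⊂ ⊤ → ¬ IsOddSunflowerIn F I)

Uniform : ∀ {m n} → ℕ → (Fin m → Subset n) → Set
Uniform {m} k F = (i : Fin m) → ∣ F i ∣ ≡ k

-- The degree d of x is odd, so it suffices to rule out d ≥ 5; call the members through x link
-- sets. By minimality no proper subfamily with at least two members has all its degrees zero or
-- odd. Applied to three link sets forming a sunflower, this shows that no point other than x lies
-- in three link sets; applied to a link set and a disjoint non-link set, that every link set
-- meets every non-link set; applied to the complement of a subfamily J, that J cannot have all its
-- degrees even or equal to the full degree. If a point y of a non-link set c lay in a single link
-- set {x, y, a}, the other link sets would avoid y and split two and two over the remaining points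
-- of c, and three link sets pairwise meeting only in x could be chosen. Taking J to be all link
-- sets then shows that there is a single non-link set c₀. Finally take a link set through a point
-- c₁ of c₀ and three link sets avoiding c₁: either two of them contain the same points of c₀, and
-- J is that pair, or one of them contains the two other points of c₀, and J consists of it, the
-- link set through c₁ and c₀.
module Submission where

open import Defs
open import Data.Empty using (⊥; ⊥-elim)
open import Data.Fin using (Fin; zero; suc; _≟_)
open import Data.Fin.Subset renaming (⊥ to ∅)
open import Data.Fin.Subset.Properties
open import Data.Nat using (ℕ; suc; _+_; _%_; _≤_; _<_; z≤n; s≤s; s≤s⁻¹; _≤?_)
open import Data.Nat.DivMod using (m%n%n≡m%n; %-distribˡ-+)
open import Data.Nat.Properties
  using (≤-reflexive; ≤-trans; ≤-antisym; ≤-<-trans; <⇒≢; <⇒≱; ≰⇒>; n≤1+n; m≤m+n;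
         +-suc; +-identityʳ; +-cancelˡ-≡; +-cancelˡ-≤; +-mono-≤; +-monoˡ-≤; +-monoʳ-≤; ∸-mono;
         m+n≡0⇒n≡0; module ≤-Reasoning)
open import Data.Product using (∃; ∃₂; _×_; _,_; proj₁; proj₂; uncurry)
open import Data.Sum as Sum using (_⊎_; inj₁; inj₂)
open import Data.Vec using (_∷_; []; here; there; lookup)
open import Data.Vec.Properties using (lookup∘tabulate; []=⇒lookup; lookup⇒[]=)
open import Function using (_∘_)
open import Function.Definitions using (Injective)
open import Relation.Nullary using (¬_; yes; no)
open import Relation.Nullary.Negation using (contradiction)
open import Relation.Binary.PropositionalEquality
  using (_≡_; _≢_; refl; sym; trans; cong; cong₂; subst; ≢-sym; module ≡-Reasoning)

private variable
  n : ℕ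
  p q : Subset n
  x y z : Fin n

-- Counting in finite subsets

∣p∣≡∣p∩q∣+∣p∩∁q∣ : ∀ (p q : Subset n) → ∣ p ∣ ≡ ∣ p ∩ q ∣ + ∣ p ∩ ∁ q ∣
∣p∣≡∣p∩q∣+∣p∩∁q∣ []            []            = refl
∣p∣≡∣p∩q∣+∣p∩∁q∣ (inside  ∷ p) (inside  ∷ q) = cong suc (∣p∣≡∣p∩q∣+∣p∩∁q∣ p q)
∣p∣≡∣p∩q∣+∣p∩∁q∣ (inside  ∷ p) (outside ∷ q) =
  trans (cong suc (∣p∣≡∣p∩q∣+∣p∩∁q∣ p q)) (sym (+-suc _ _))
∣p∣≡∣p∩q∣+∣p∩∁q∣ (outside ∷ p) (_       ∷ q) = ∣p∣≡∣p∩q∣+∣p∩∁q∣ p q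

private
  ∃∈p∉q-there : ∀ {s t} → (∃ λ x → x ∈ p × x ∉ q) → ∃ λ x → x ∈ s ∷ p × x ∉ t ∷ q
  ∃∈p∉q-there (x , x∈p , x∉q) = suc x , there x∈p , x∉q ∘ drop-there

∣q∣<∣p∣⇒∃∈p∉q : ∀ (p q : Subset n) → ∣ q ∣ < ∣ p ∣ → ∃ λ x → x ∈ p × x ∉ q
∣q∣<∣p∣⇒∃∈p∉q (inside  ∷ p) (outside ∷ q) _  = zero , here , λ ()
∣q∣<∣p∣⇒∃∈p∉q (inside  ∷ p) (inside  ∷ q) lt = ∃∈p∉q-there (∣q∣<∣p∣⇒∃∈p∉q p q (s≤s⁻¹ lt))
∣q∣<∣p∣⇒∃∈p∉q (outside ∷ p) (s       ∷ q) lt =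
  ∃∈p∉q-there (∣q∣<∣p∣⇒∃∈p∉q p q (≤-<-trans (∣p∣≤∣x∷p∣ s q) lt))

p⊆q∧∣q∣≤∣p∣⇒p≡q : p ⊆ q → ∣ q ∣ ≤ ∣ p ∣ → p ≡ q
p⊆q∧∣q∣≤∣p∣⇒p≡q {p = []}          {[]}          _   _  = refl
p⊆q∧∣q∣≤∣p∣⇒p≡q {p = inside  ∷ p} {inside  ∷ q} p⊆q le =
  cong (inside ∷_) (p⊆q∧∣q∣≤∣p∣⇒p≡q (drop-∷-⊆ p⊆q) (s≤s⁻¹ le))
p⊆q∧∣q∣≤∣p∣⇒p≡q {p = outside ∷ p} {outside ∷ q} p⊆q le =
  cong (outside ∷_) (p⊆q∧∣q∣≤∣p∣⇒p≡q (drop-∷-⊆ p⊆q) le)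
p⊆q∧∣q∣≤∣p∣⇒p≡q {p = outside ∷ p} {inside  ∷ q} p⊆q le =
  contradiction le (<⇒≱ (s≤s (p⊆q⇒∣p∣≤∣q∣ (drop-∷-⊆ p⊆q))))
p⊆q∧∣q∣≤∣p∣⇒p≡q {p = inside  ∷ p} {outside ∷ q} p⊆q _  with () ← p⊆q here

∣⁅x⁆∪p∣≡1+∣p∣ : x ∉ p → ∣ ⁅ x ⁆ ∪ p ∣ ≡ suc ∣ p ∣
∣⁅x⁆∪p∣≡1+∣p∣ {x = zero}  {p = outside ∷ p} _   = cong (suc ∘ ∣_∣) (∪-identityˡ p)
∣⁅x⁆∪p∣≡1+∣p∣ {x = zero}  {p = inside  ∷ p} x∉p = contradiction here x∉p
∣⁅x⁆∪p∣≡1+∣p∣ {x = suc x} {p = inside  ∷ p} x∉p = cong suc (∣⁅x⁆∪p∣≡1+∣p∣ (x∉p ∘ there))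
∣⁅x⁆∪p∣≡1+∣p∣ {x = suc x} {p = outside ∷ p} x∉p = ∣⁅x⁆∪p∣≡1+∣p∣ (x∉p ∘ there)

x∈p∧y∉p⇒x≢y : x ∈ p → y ∉ p → x ≢ y
x∈p∧y∉p⇒x≢y x∈p y∉p refl = y∉p x∈p

∈⁅x⁆∪p⁻ : z ∈ ⁅ x ⁆ ∪ p → z ≡ x ⊎ z ∈ p
∈⁅x⁆∪p⁻ {x = x} {p = p} = Sum.map₁ (x∈⁅y⁆⇒x≡y x) ∘ x∈p∪q⁻ ⁅ x ⁆ p

∈⁅x⁆∪⁅y⁆⁻ : z ∈ ⁅ x ⁆ ∪ ⁅ y ⁆ → z ≡ x ⊎ z ≡ y
∈⁅x⁆∪⁅y⁆⁻ = Sum.map₂ (x∈⁅y⁆⇒x≡y _) ∘ ∈⁅x⁆∪p⁻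

∈⁅x⁆∪⁅y⁆∪⁅z⁆⁻ : ∀ {w} → w ∈ ⁅ x ⁆ ∪ ⁅ y ⁆ ∪ ⁅ z ⁆ → w ≡ x ⊎ w ≡ y ⊎ w ≡ z
∈⁅x⁆∪⁅y⁆∪⁅z⁆⁻ = Sum.map₂ ∈⁅x⁆∪⁅y⁆⁻ ∘ ∈⁅x⁆∪p⁻

x∈⁅x⁆∪p : x ∈ ⁅ x ⁆ ∪ p
x∈⁅x⁆∪p {x = x} = x∈p∪q⁺ (inj₁ (x∈⁅x⁆ x))

y∈⁅x⁆∪⁅y⁆∪⁅z⁆ : y ∈ ⁅ x ⁆ ∪ ⁅ y ⁆ ∪ ⁅ z ⁆
y∈⁅x⁆∪⁅y⁆∪⁅z⁆ = x∈p∪q⁺ (inj₂ x∈⁅x⁆∪p)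

z∈⁅x⁆∪⁅y⁆∪⁅z⁆ : z ∈ ⁅ x ⁆ ∪ ⁅ y ⁆ ∪ ⁅ z ⁆
z∈⁅x⁆∪⁅y⁆∪⁅z⁆ {z = z} = x∈p∪q⁺ (inj₂ (x∈p∪q⁺ (inj₂ (x∈⁅x⁆ z))))

p≡⁅x⁆∪⁅y⁆∪⁅z⁆⇒∈ : p ≡ ⁅ x ⁆ ∪ ⁅ y ⁆ ∪ ⁅ z ⁆ → x ∈ p × y ∈ p × z ∈ p
p≡⁅x⁆∪⁅y⁆∪⁅z⁆⇒∈ refl = x∈⁅x⁆∪p , y∈⁅x⁆∪⁅y⁆∪⁅z⁆ , z∈⁅x⁆∪⁅y⁆∪⁅z⁆

⁅x⁆⊆p : x ∈ p → ⁅ x ⁆ ⊆ p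
⁅x⁆⊆p {x = x} x∈p z∈ with refl ← x∈⁅y⁆⇒x≡y x z∈ = x∈p

⁅x⁆∪p⊆q : x ∈ q → p ⊆ q → ⁅ x ⁆ ∪ p ⊆ q
⁅x⁆∪p⊆q x∈q p⊆q z∈ = Sum.[ (λ { refl → x∈q }) , p⊆q ] (∈⁅x⁆∪p⁻ z∈)

⁅x⁆∪⁅y⁆⊆p : x ∈ p → y ∈ p → ⁅ x ⁆ ∪ ⁅ y ⁆ ⊆ p
⁅x⁆∪⁅y⁆⊆p x∈p y∈p = ⁅x⁆∪p⊆q x∈p (⁅x⁆⊆p y∈p)

⁅x⁆∪⁅y⁆∪⁅z⁆⊆p : x ∈ p → y ∈ p → z ∈ p → ⁅ x ⁆ ∪ ⁅ y ⁆ ∪ ⁅ z ⁆ ⊆ p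
⁅x⁆∪⁅y⁆∪⁅z⁆⊆p x∈p y∈p z∈p = ⁅x⁆∪p⊆q x∈p (⁅x⁆∪⁅y⁆⊆p y∈p z∈p)

∣⁅x⁆∪⁅y⁆∣≡2 : x ≢ y → ∣ ⁅ x ⁆ ∪ ⁅ y ⁆ ∣ ≡ 2
∣⁅x⁆∪⁅y⁆∣≡2 {y = y} x≢y = trans (∣⁅x⁆∪p∣≡1+∣p∣ (x≢y⇒x∉⁅y⁆ x≢y)) (cong suc (∣⁅x⁆∣≡1 y))

∣⁅x⁆∪⁅y⁆∪⁅z⁆∣≡3 : x ≢ y → x ≢ z → y ≢ z → ∣ ⁅ x ⁆ ∪ ⁅ y ⁆ ∪ ⁅ z ⁆ ∣ ≡ 3
∣⁅x⁆∪⁅y⁆∪⁅z⁆∣≡3 x≢y x≢z y≢z =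
  trans (∣⁅x⁆∪p∣≡1+∣p∣ (Sum.[ x≢y , x≢z ] ∘ ∈⁅x⁆∪⁅y⁆⁻)) (cong suc (∣⁅x⁆∪⁅y⁆∣≡2 y≢z))

nonempty : ∀ {n} {p : Subset n} → 1 ≤ ∣ p ∣ → Nonempty p
nonempty {n} {p} 1≤∣p∣ with nonempty? p
... | yes ne  = ne
... | no  ¬ne = contradiction (trans (cong ∣_∣ (Empty-unique ¬ne)) (∣⊥∣≡0 n)) (≢-sym (<⇒≢ 1≤∣p∣))

∃-other : x ∈ p → 2 ≤ ∣ p ∣ → ∃ λ y → y ∈ p × y ≢ x
∃-other {x = x} {p = p} _ 2≤∣p∣ with ∣q∣<∣p∣⇒∃∈p∉q p ⁅ x ⁆ (subst (_< ∣ p ∣) (sym (∣⁅x⁆∣≡1 x)) 2≤∣p∣)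
... | y , y∈p , y∉⁅x⁆ = y , y∈p , x∉⁅y⁆⇒x≢y y∉⁅x⁆

∃-third : x ≢ y → 3 ≤ ∣ p ∣ → ∃ λ z → z ∈ p × z ≢ x × z ≢ y
∃-third {x = x} {y} {p} x≢y 3≤∣p∣
  with ∣q∣<∣p∣⇒∃∈p∉q p (⁅ x ⁆ ∪ ⁅ y ⁆) (subst (_< ∣ p ∣) (sym (∣⁅x⁆∪⁅y⁆∣≡2 x≢y)) 3≤∣p∣)
... | z , z∈p , z∉ = z , z∈p , (λ { refl → z∉ x∈⁅x⁆∪p }) , (λ { refl → z∉ (x∈p∪q⁺ (inj₂ (x∈⁅x⁆ y))) })

∃-pair : 2 ≤ ∣ p ∣ → ∃₂ λ x y → x ≢ y × x ∈ p × y ∈ p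
∃-pair 2≤∣p∣ with nonempty (≤-trans (s≤s z≤n) 2≤∣p∣)
... | x , x∈p with ∃-other x∈p 2≤∣p∣
...   | y , y∈p , y≢x = x , y , ≢-sym y≢x , x∈p , y∈p

∃-triple : 3 ≤ ∣ p ∣ → ∃₂ λ x y → ∃ λ z → x ≢ y × x ≢ z × y ≢ z × x ∈ p × y ∈ p × z ∈ p
∃-triple 3≤∣p∣ with ∃-pair (≤-trans (s≤s (s≤s z≤n)) 3≤∣p∣)
... | x , y , x≢y , x∈p , y∈p with ∃-third x≢y 3≤∣p∣
...   | z , z∈p , z≢x , z≢y = x , y , z , x≢y , ≢-sym z≢x , ≢-sym z≢y , x∈p , y∈p , z∈p

∣p∣≤1 : (∀ {x y} → x ∈ p → y ∈ p → x ≡ y) → ∣ p ∣ ≤ 1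
∣p∣≤1 {p = p} unique with 2 ≤? ∣ p ∣
... | no  2≰∣p∣ = s≤s⁻¹ (≰⇒> 2≰∣p∣)
... | yes 2≤∣p∣ with ∃-pair 2≤∣p∣
...   | _ , _ , x≢y , x∈p , y∈p = contradiction (unique x∈p y∈p) x≢y

∣p∣≡3⇒p≡⁅x⁆∪⁅y⁆∪⁅z⁆ : ∣ p ∣ ≡ 3 → x ≢ y → x ≢ z → y ≢ z → x ∈ p → y ∈ p → z ∈ p →
                      p ≡ ⁅ x ⁆ ∪ ⁅ y ⁆ ∪ ⁅ z ⁆
∣p∣≡3⇒p≡⁅x⁆∪⁅y⁆∪⁅z⁆ ∣p∣≡3 x≢y x≢z y≢z x∈p y∈p z∈p = sym (p⊆q∧∣q∣≤∣p∣⇒p≡q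
  (⁅x⁆∪⁅y⁆∪⁅z⁆⊆p x∈p y∈p z∈p) (≤-reflexive (trans ∣p∣≡3 (sym (∣⁅x⁆∪⁅y⁆∪⁅z⁆∣≡3 x≢y x≢z y≢z)))))

∣p∣≡3⇒∃-completion : ∣ p ∣ ≡ 3 → x ∈ p → y ∈ p → x ≢ y →
                     ∃ λ z → z ≢ x × z ≢ y × p ≡ ⁅ x ⁆ ∪ ⁅ y ⁆ ∪ ⁅ z ⁆
∣p∣≡3⇒∃-completion ∣p∣≡3 x∈p y∈p x≢y with ∃-third x≢y (≤-reflexive (sym ∣p∣≡3))
... | z , z∈p , z≢x , z≢y =
  z , z≢x , z≢y , ∣p∣≡3⇒p≡⁅x⁆∪⁅y⁆∪⁅z⁆ ∣p∣≡3 x≢y (≢-sym z≢x) (≢-sym z≢y) x∈p y∈p z∈p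

Even : ℕ → Set
Even k = k % 2 ≡ 0

Even∧0⊎Odd[+]⇒0⊎Odd : ∀ a b → Even a → a + b ≡ 0 ⊎ Odd (a + b) → b ≡ 0 ⊎ Odd b
Even∧0⊎Odd[+]⇒0⊎Odd a b _     (inj₁ a+b≡0) = inj₁ (m+n≡0⇒n≡0 a a+b≡0)
Even∧0⊎Odd[+]⇒0⊎Odd a b a%2≡0 (inj₂ odd)   = inj₂ (begin
  b % 2                ≡⟨ m%n%n≡m%n b 2 ⟨
  (0 + b % 2) % 2      ≡⟨ cong (λ r → (r + b % 2) % 2) a%2≡0 ⟨
  (a % 2 + b % 2) % 2  ≡⟨ %-distribˡ-+ a b 2 ⟨
  (a + b) % 2          ≡⟨ odd ⟩
  1                    ∎)
  where open ≡-Reasoning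

≤1⊎≡3⇒0⊎Odd : ∀ {d} → d ≤ 1 ⊎ d ≡ 3 → d ≡ 0 ⊎ Odd d
≤1⊎≡3⇒0⊎Odd (inj₁ z≤n)       = inj₁ refl
≤1⊎≡3⇒0⊎Odd (inj₁ (s≤s z≤n)) = inj₂ refl
≤1⊎≡3⇒0⊎Odd (inj₂ refl)      = inj₂ refl

≤2⇒Even⊎≡1 : ∀ {d} → d ≤ 2 → Even d ⊎ d ≡ 1
≤2⇒Even⊎≡1 z≤n             = inj₁ refl
≤2⇒Even⊎≡1 (s≤s z≤n)       = inj₂ refl
≤2⇒Even⊎≡1 (s≤s (s≤s z≤n)) = inj₁ refl

≤2∧0⊎Odd⇒≤1 : ∀ {d} → d ≤ 2 → d ≡ 0 ⊎ Odd d → d ≤ 1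
≤2∧0⊎Odd⇒≤1 z≤n             _         = z≤n
≤2∧0⊎Odd⇒≤1 (s≤s z≤n)       _         = s≤s z≤n
≤2∧0⊎Odd⇒≤1 (s≤s (s≤s z≤n)) (inj₁ ())
≤2∧0⊎Odd⇒≤1 (s≤s (s≤s z≤n)) (inj₂ ())

≤∧≤1⇒Even⊎≡ : ∀ {a b} → a ≤ b → b ≤ 1 → Even a ⊎ a ≡ b
≤∧≤1⇒Even⊎≡ z≤n       _         = inj₁ refl
≤∧≤1⇒Even⊎≡ (s≤s z≤n) (s≤s z≤n) = inj₂ refl

2≤∧≤∧≤3⇒Even⊎≡ : ∀ {a b} → 2 ≤ a → a ≤ b → b ≤ 3 → Even a ⊎ a ≡ b
2≤∧≤∧≤3⇒Even⊎≡ {a} 2≤a a≤b b≤3 with a ≤? 2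
... | yes a≤2 = inj₁ (subst Even (≤-antisym 2≤a a≤2) refl)
... | no  a≰2 = inj₂ (≤-antisym a≤b (≤-trans b≤3 (≰⇒> a≰2)))

2≤∧<5∧0⊎Odd⇒≡3 : ∀ {d} → 2 ≤ d → d < 5 → d ≡ 0 ⊎ Odd d → d ≡ 3
2≤∧<5∧0⊎Odd⇒≡3 {1} (s≤s ()) _ _
2≤∧<5∧0⊎Odd⇒≡3 {2} _ _ (inj₁ ())
2≤∧<5∧0⊎Odd⇒≡3 {2} _ _ (inj₂ ())
2≤∧<5∧0⊎Odd⇒≡3 {3} _ _ _ = refl
2≤∧<5∧0⊎Odd⇒≡3 {4} _ _ (inj₁ ())
2≤∧<5∧0⊎Odd⇒≡3 {4} _ _ (inj₂ ())
2≤∧<5∧0⊎Odd⇒≡3 {suc (suc (suc (suc (suc _))))} _ (s≤s (s≤s (s≤s (s≤s (s≤s ()))))) _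

-- Degrees in subfamilies

module _ {m n} (F : Fin m → Subset n) where

  private variable
    i j : Fin m
    v : Fin n
    I : Subset m

  IsSunflowerIn : Subset m → Set
  IsSunflowerIn I = ∀ {v i j} → i ∈ I → j ∈ I → i ≢ j → v ∈ F i → v ∈ F j → I ⊆ containing F v

  ∈containing⁺ : v ∈ F i → i ∈ containing F v
  ∈containing⁺ {v} {i} v∈i =
    lookup⇒[]= i _ (trans (lookup∘tabulate (λ j → lookup (F j) v) i) ([]=⇒lookup v∈i))

  ∈containing⁻ : i ∈ containing F v → v ∈ F i
  ∈containing⁻ {i} {v} i∈ =
    lookup⇒[]= v (F i) (trans (sym (lookup∘tabulate (λ j → lookup (F j) v) i)) ([]=⇒lookup i∈))

  ∈∧∉⇒≢ : v ∈ F i → v ∉ F j → i ≢ j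
  ∈∧∉⇒≢ v∈i v∉j refl = v∉j v∈i

  deg≡∣containing∣ : ∀ v → deg F v ≡ ∣ containing F v ∣
  deg≡∣containing∣ v = cong ∣_∣ (∩-identityˡ (containing F v))

  deg≡degIn+degIn∁ : ∀ J v → deg F v ≡ degIn F J v + degIn F (∁ J) v
  deg≡degIn+degIn∁ J v = begin
    deg F v                        ≡⟨ deg≡∣containing∣ v ⟩
    ∣ C ∣                          ≡⟨ ∣p∣≡∣p∩q∣+∣p∩∁q∣ C J ⟩
    ∣ C ∩ J ∣ + ∣ C ∩ ∁ J ∣        ≡⟨ cong₂ (λ a b → ∣ a ∣ + ∣ b ∣) (∩-comm C J) (∩-comm C (∁ J)) ⟩
    degIn F J v + degIn F (∁ J) v  ∎
    where
    open ≡-Reasoning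
    C = containing F v

  degIn≤deg : ∀ J v → degIn F J v ≤ deg F v
  degIn≤deg J v = subst (degIn F J v ≤_) (sym (deg≡degIn+degIn∁ J v)) (m≤m+n _ _)

  ∣K∣≤degIn : ∀ {K} → K ⊆ I → K ⊆ containing F v → ∣ K ∣ ≤ degIn F I v
  ∣K∣≤degIn K⊆I K⊆C = p⊆q⇒∣p∣≤∣q∣ (λ i∈K → x∈p∩q⁺ (K⊆I i∈K , K⊆C i∈K))

  degIn≡∣I∣ : I ⊆ containing F v → degIn F I v ≡ ∣ I ∣
  degIn≡∣I∣ {I} {v} I⊆C = ≤-antisym (∣p∩q∣≤∣p∣ I (containing F v)) (∣K∣≤degIn (λ i∈I → i∈I) I⊆C)

  degIn≤1 : (∀ {i j} → i ∈ I → j ∈ I → v ∈ F i → v ∈ F j → i ≡ j) → degIn F I v ≤ 1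
  degIn≤1 {I} {v} unique = ∣p∣≤1 λ i∈ j∈ →
    let (i∈I , i∈C) = x∈p∩q⁻ I _ i∈ ; (j∈I , j∈C) = x∈p∩q⁻ I _ j∈
    in unique i∈I j∈I (∈containing⁻ i∈C) (∈containing⁻ j∈C)

  degIn≡0 : (∀ {i} → i ∈ I → v ∉ F i) → degIn F I v ≡ 0
  degIn≡0 {I} {v} missing = trans (cong ∣_∣ (Empty-unique λ (i , i∈) →
    let (i∈I , i∈C) = x∈p∩q⁻ I _ i∈ in missing i∈I (∈containing⁻ i∈C))) (∣⊥∣≡0 m)

  degIn-⁅i⁆∪-∉ : v ∉ F i → degIn F (⁅ i ⁆ ∪ I) v ≡ degIn F I v
  degIn-⁅i⁆∪-∉ {v} {i} {I} v∉i = begin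
    ∣ (⁅ i ⁆ ∪ I) ∩ C ∣        ≡⟨ cong ∣_∣ (∩-distribʳ-∪ C ⁅ i ⁆ I) ⟩
    ∣ (⁅ i ⁆ ∩ C) ∪ (I ∩ C) ∣  ≡⟨ cong (λ a → ∣ a ∪ (I ∩ C) ∣) (Empty-unique ⁅i⁆∩C-empty) ⟩
    ∣ ∅ ∪ (I ∩ C) ∣            ≡⟨ cong ∣_∣ (∪-identityˡ (I ∩ C)) ⟩
    ∣ I ∩ C ∣                  ∎
    where
    open ≡-Reasoning
    C = containing F v
    ⁅i⁆∩C-empty : Empty (⁅ i ⁆ ∩ C)
    ⁅i⁆∩C-empty (j , j∈) with x∈p∩q⁻ ⁅ i ⁆ C j∈
    ... | j∈⁅i⁆ , j∈C with refl ← x∈⁅y⁆⇒x≡y i j∈⁅i⁆ = v∉i (∈containing⁻ j∈C)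

  sunflower⇒degIn≤1⊎≡∣I∣ : IsSunflowerIn I → ∀ v → degIn F I v ≤ 1 ⊎ degIn F I v ≡ ∣ I ∣
  sunflower⇒degIn≤1⊎≡∣I∣ {I} sunflower v with 2 ≤? degIn F I v
  ... | no  2≰d = inj₁ (s≤s⁻¹ (≰⇒> 2≰d))
  ... | yes 2≤d with ∃-pair 2≤d
  ...   | i , j , i≢j , i∈ , j∈ =
    let (i∈I , i∈C) = x∈p∩q⁻ I _ i∈ ; (j∈I , j∈C) = x∈p∩q⁻ I _ j∈
    in inj₂ (degIn≡∣I∣ (sunflower i∈I j∈I i≢j (∈containing⁻ i∈C) (∈containing⁻ j∈C)))

-- Consequences of minimality

module _ {m n} {F : Fin m → Subset n} (minimal : IsMinimalOddSunflower F) where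

  deg≡0⊎Odd : ∀ v → deg F v ≡ 0 ⊎ Odd (deg F v)
  deg≡0⊎Odd = proj₂ (proj₂ (proj₁ minimal))

  ¬oddSubfamily : ∀ {l} (I : Subset m) → l ∉ I → 2 ≤ ∣ I ∣ →
                  (∀ v → degIn F I v ≡ 0 ⊎ Odd (degIn F I v)) → ⊥
  ¬oddSubfamily I l∉I 2≤∣I∣ odd = proj₂ minimal I (⊆⊤ , _ , ∈⊤ , l∉I)
    (2≤∣I∣ , (λ i _ → proj₁ (proj₂ (proj₁ minimal)) i ∈⊤) , odd)

  ¬sunflower₃ : ∀ {l} (I : Subset m) → l ∉ I → ∣ I ∣ ≡ 3 → IsSunflowerIn F I → ⊥
  ¬sunflower₃ I l∉I ∣I∣≡3 sunflower = ¬oddSubfamily I l∉I (subst (2 ≤_) (sym ∣I∣≡3) (s≤s (s≤s z≤n)))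
    λ v → ≤1⊎≡3⇒0⊎Odd (Sum.map₂ (λ d≡∣I∣ → trans d≡∣I∣ ∣I∣≡3) (sunflower⇒degIn≤1⊎≡∣I∣ F sunflower v))

  ¬evenComplement : ∀ {l} (J : Subset m) → l ∈ J → 2 ≤ ∣ ∁ J ∣ →
                    (∀ v → Even (degIn F J v) ⊎ degIn F J v ≡ deg F v) → ⊥
  ¬evenComplement J l∈J 2≤∣∁J∣ even⊎full =
    ¬oddSubfamily (∁ J) (x∈p⇒x∉∁p l∈J) 2≤∣∁J∣ λ v → complement v (even⊎full v)
    where
    complement : ∀ v → Even (degIn F J v) ⊎ degIn F J v ≡ deg F v →
                 degIn F (∁ J) v ≡ 0 ⊎ Odd (degIn F (∁ J) v)
    complement v (inj₁ even) = Even∧0⊎Odd[+]⇒0⊎Odd _ _ even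
      (subst (λ d → d ≡ 0 ⊎ Odd d) (deg≡degIn+degIn∁ F J v) (deg≡0⊎Odd v))
    complement v (inj₂ full) = inj₁ (+-cancelˡ-≡ (degIn F J v) _ 0 (begin
      degIn F J v + degIn F (∁ J) v  ≡⟨ deg≡degIn+degIn∁ F J v ⟨
      deg F v                        ≡⟨ full ⟨
      degIn F J v                    ≡⟨ +-identityʳ _ ⟨
      degIn F J v + 0                ∎))
      where open ≡-Reasoning

module _ {m n} {F : Fin m → Subset n} (injective : Injective _≡_ _≡_ F) (uniform : Uniform 3 F) where

  ≡-of-three-common : ∀ {i j} → x ≢ y → x ≢ z → y ≢ z →
                      x ∈ F i → y ∈ F i → z ∈ F i → x ∈ F j → y ∈ F j → z ∈ F j → i ≡ j
  ≡-of-three-common {i = i} {j} x≢y x≢z y≢z x∈i y∈i z∈i x∈j y∈j z∈j = injective (trans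
    (∣p∣≡3⇒p≡⁅x⁆∪⁅y⁆∪⁅z⁆ (uniform i) x≢y x≢z y≢z x∈i y∈i z∈i)
    (sym (∣p∣≡3⇒p≡⁅x⁆∪⁅y⁆∪⁅z⁆ (uniform j) x≢y x≢z y≢z x∈j y∈j z∈j)))

-- A point of degree at least five

module DegreeAtLeastFive
  {m n} (F : Fin m → Subset n) (injective : Injective _≡_ _≡_ F) (uniform : Uniform 3 F)
  (minimal : IsMinimalOddSunflower F) (noKernel : ∀ v → ∃ λ i → v ∉ F i)
  (x : Fin n) (5≤deg : 5 ≤ deg F x) where

  private variable
    i j k c : Fin m
    s t u v w : Fin n

  Link : Subset m
  Link = containing F x

  Through : Fin n → Subset m
  Through w = Link ∩ containing F w

  Avoiding : Fin n → Subset m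
  Avoiding w = Link ∩ ∁ (containing F w)

  linkDeg : Fin n → ℕ
  linkDeg = degIn F Link

  ∈Through⁺ : x ∈ F i → w ∈ F i → i ∈ Through w
  ∈Through⁺ x∈i w∈i = x∈p∩q⁺ (∈containing⁺ F x∈i , ∈containing⁺ F w∈i)

  ∈Through⁻ : i ∈ Through w → x ∈ F i × w ∈ F i
  ∈Through⁻ i∈ = let (i∈Link , i∈C) = x∈p∩q⁻ Link _ i∈ in ∈containing⁻ F i∈Link , ∈containing⁻ F i∈C

  ∈Avoiding⁻ : i ∈ Avoiding w → x ∈ F i × w ∉ F i
  ∈Avoiding⁻ i∈ = let (i∈Link , i∈∁C) = x∈p∩q⁻ Link _ i∈
                  in ∈containing⁻ F i∈Link , x∈∁p⇒x∉p i∈∁C ∘ ∈containing⁺ F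

  5≤∣Link∣ : 5 ≤ ∣ Link ∣
  5≤∣Link∣ = subst (5 ≤_) (deg≡∣containing∣ F x) 5≤deg

  link₀ : Nonempty Link
  link₀ = nonempty (≤-trans (s≤s z≤n) 5≤∣Link∣)

  l₀ : Fin m
  l₀ = proj₁ link₀

  x∈l₀ : x ∈ F l₀
  x∈l₀ = ∈containing⁻ F (proj₂ link₀)

  c₀ : Fin m
  c₀ = proj₁ (noKernel x)

  x∉c₀ : x ∉ F c₀
  x∉c₀ = proj₂ (noKernel x)

  2≤∣F∣ : ∀ i → 2 ≤ ∣ F i ∣
  2≤∣F∣ i = subst (2 ≤_) (sym (uniform i)) (s≤s (s≤s z≤n))

  ¬linkSunflower₃ : i ≢ j → i ≢ k → j ≢ k → ⁅ i ⁆ ∪ ⁅ j ⁆ ∪ ⁅ k ⁆ ⊆ Link →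
                    IsSunflowerIn F (⁅ i ⁆ ∪ ⁅ j ⁆ ∪ ⁅ k ⁆) → ⊥
  ¬linkSunflower₃ i≢j i≢k j≢k T⊆Link =
    ¬sunflower₃ minimal _ (x∉c₀ ∘ ∈containing⁻ F ∘ T⊆Link) (∣⁅x⁆∪⁅y⁆∪⁅z⁆∣≡3 i≢j i≢k j≢k)

  ¬three-through : w ≢ x → i ≢ j → i ≢ k → j ≢ k →
                   i ∈ Through w → j ∈ Through w → k ∈ Through w → ⊥
  ¬three-through {w} {i} {j} {k} w≢x i≢j i≢k j≢k i∈ j∈ k∈ =
    ¬linkSunflower₃ i≢j i≢k j≢k (p∩q⊆p Link _ ∘ T⊆Through) sunflower
    where
    T⊆Through : ⁅ i ⁆ ∪ ⁅ j ⁆ ∪ ⁅ k ⁆ ⊆ Through w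
    T⊆Through = ⁅x⁆∪⁅y⁆∪⁅z⁆⊆p i∈ j∈ k∈
    sunflower : IsSunflowerIn F (⁅ i ⁆ ∪ ⁅ j ⁆ ∪ ⁅ k ⁆)
    sunflower {v} p∈ q∈ p≢q v∈p v∈q with v ≟ x | v ≟ w
    ... | yes refl | _        = p∩q⊆p Link _ ∘ T⊆Through
    ... | no  _    | yes refl = p∩q⊆q Link _ ∘ T⊆Through
    ... | no  v≢x  | no  v≢w  =
      let (x∈p , w∈p) = ∈Through⁻ (T⊆Through p∈) ; (x∈q , w∈q) = ∈Through⁻ (T⊆Through q∈)
      in contradiction (≡-of-three-common injective uniform (≢-sym w≢x) (≢-sym v≢x) (≢-sym v≢w)
                          x∈p w∈p v∈p x∈q w∈q v∈q) p≢q

  linkDeg≤2 : w ≢ x → linkDeg w ≤ 2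
  linkDeg≤2 {w} w≢x with 3 ≤? linkDeg w
  ... | no  3≰ = s≤s⁻¹ (≰⇒> 3≰)
  ... | yes 3≤ with ∃-triple 3≤
  ...   | i , j , k , i≢j , i≢k , j≢k , i∈ , j∈ , k∈ = ⊥-elim (¬three-through w≢x i≢j i≢k j≢k i∈ j∈ k∈)

  link-meets-nonLink : x ∈ F i → x ∉ F c → Nonempty (F i ∩ F c)
  link-meets-nonLink {i} {c} x∈i x∉c with nonempty? (F i ∩ F c)
  ... | yes meet = meet
  ... | no disjoint with ∃-other (∈containing⁺ F x∈i) (≤-trans (s≤s (s≤s z≤n)) 5≤∣Link∣)
  ...   | l , l∈Link , l≢i = ⊥-elim (¬oddSubfamily minimal (⁅ i ⁆ ∪ ⁅ c ⁆) l∉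
          (≤-reflexive (sym (∣⁅x⁆∪⁅y⁆∣≡2 (∈∧∉⇒≢ F x∈i x∉c))))
          (λ v → ≤1⊎≡3⇒0⊎Odd (inj₁ (degIn≤1 F unique))))
    where
    l∉ : l ∉ ⁅ i ⁆ ∪ ⁅ c ⁆
    l∉ l∈ with ∈⁅x⁆∪⁅y⁆⁻ l∈
    ... | inj₁ refl = l≢i refl
    ... | inj₂ refl = x∉c (∈containing⁻ F l∈Link)
    unique : ∀ {v p q} → p ∈ ⁅ i ⁆ ∪ ⁅ c ⁆ → q ∈ ⁅ i ⁆ ∪ ⁅ c ⁆ → v ∈ F p → v ∈ F q → p ≡ q
    unique p∈ q∈ v∈p v∈q with ∈⁅x⁆∪⁅y⁆⁻ p∈ | ∈⁅x⁆∪⁅y⁆⁻ q∈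
    ... | inj₁ refl | inj₁ refl = refl
    ... | inj₂ refl | inj₂ refl = refl
    ... | inj₁ refl | inj₂ refl = ⊥-elim (disjoint (_ , x∈p∩q⁺ (v∈p , v∈q)))
    ... | inj₂ refl | inj₁ refl = ⊥-elim (disjoint (_ , x∈p∩q⁺ (v∈q , v∈p)))

  Touch : Fin m → Fin m → Set
  Touch i j = ∃ λ v → v ≢ x × v ∈ F i × v ∈ F j

  ¬Touch-sym : ¬ Touch i j → ¬ Touch j i
  ¬Touch-sym ¬ij (v , v≢x , v∈j , v∈i) = ¬ij (v , v≢x , v∈i , v∈j)

  ¬Touch⇒≢ : x ∈ F i → ¬ Touch i j → i ≢ j
  ¬Touch⇒≢ {i} x∈i ¬ij refl with ∃-other x∈i (2≤∣F∣ i)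
  ... | v , v∈i , v≢x = ¬ij (v , v≢x , v∈i , v∈i)

  ¬pairwiseApart : x ∈ F i → x ∈ F j → x ∈ F k → ¬ Touch i j → ¬ Touch i k → ¬ Touch j k → ⊥
  ¬pairwiseApart {i} {j} {k} x∈i x∈j x∈k ¬ij ¬ik ¬jk =
    ¬linkSunflower₃ (¬Touch⇒≢ x∈i ¬ij) (¬Touch⇒≢ x∈i ¬ik) (¬Touch⇒≢ x∈j ¬jk) T⊆Link sunflower
    where
    T⊆Link = ⁅x⁆∪⁅y⁆∪⁅z⁆⊆p (∈containing⁺ F x∈i) (∈containing⁺ F x∈j) (∈containing⁺ F x∈k)
    sunflower : IsSunflowerIn F (⁅ i ⁆ ∪ ⁅ j ⁆ ∪ ⁅ k ⁆)
    sunflower {v} p∈ q∈ p≢q v∈p v∈q with v ≟ x | ∈⁅x⁆∪⁅y⁆∪⁅z⁆⁻ p∈ | ∈⁅x⁆∪⁅y⁆∪⁅z⁆⁻ q∈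
    ... | yes refl | _ | _ = T⊆Link
    ... | no  _    | inj₁ refl        | inj₁ refl        = contradiction refl p≢q
    ... | no  _    | inj₂ (inj₁ refl) | inj₂ (inj₁ refl) = contradiction refl p≢q
    ... | no  _    | inj₂ (inj₂ refl) | inj₂ (inj₂ refl) = contradiction refl p≢q
    ... | no  v≢x  | inj₁ refl        | inj₂ (inj₁ refl) = ⊥-elim (¬ij (v , v≢x , v∈p , v∈q))
    ... | no  v≢x  | inj₁ refl        | inj₂ (inj₂ refl) = ⊥-elim (¬ik (v , v≢x , v∈p , v∈q))
    ... | no  v≢x  | inj₂ (inj₁ refl) | inj₂ (inj₂ refl) = ⊥-elim (¬jk (v , v≢x , v∈p , v∈q))
    ... | no  v≢x  | inj₂ (inj₁ refl) | inj₁ refl        = ⊥-elim (¬ij (v , v≢x , v∈q , v∈p))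
    ... | no  v≢x  | inj₂ (inj₂ refl) | inj₁ refl        = ⊥-elim (¬ik (v , v≢x , v∈q , v∈p))
    ... | no  v≢x  | inj₂ (inj₂ refl) | inj₂ (inj₁ refl) = ⊥-elim (¬jk (v , v≢x , v∈q , v∈p))

  missing⇒¬Touch : F i ≡ ⁅ x ⁆ ∪ ⁅ s ⁆ ∪ ⁅ t ⁆ → s ∉ F j → t ∉ F j → ¬ Touch i j
  missing⇒¬Touch Fi≡ s∉j t∉j (v , v≢x , v∈i , v∈j) with ∈⁅x⁆∪⁅y⁆∪⁅z⁆⁻ (subst (v ∈_) Fi≡ v∈i)
  ... | inj₁ refl        = v≢x refl
  ... | inj₂ (inj₁ refl) = s∉j v∈j
  ... | inj₂ (inj₂ refl) = t∉j v∈j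

  ¬Touch-one-of : F i ≡ ⁅ x ⁆ ∪ ⁅ s ⁆ ∪ ⁅ t ⁆ → t ≢ x → j ≢ k → x ∈ F j → x ∈ F k →
                  s ∉ F j → s ∉ F k → ¬ Touch i j ⊎ ¬ Touch i k
  ¬Touch-one-of {i} {s} {t} {j} {k} Fi≡ t≢x j≢k x∈j x∈k s∉j s∉k with t ∈? F j | t ∈? F k
  ... | no  t∉j | _       = inj₁ (missing⇒¬Touch Fi≡ s∉j t∉j)
  ... | yes _   | no  t∉k = inj₂ (missing⇒¬Touch Fi≡ s∉k t∉k)
  ... | yes t∈j | yes t∈k =
    let (x∈i , s∈i , t∈i) = p≡⁅x⁆∪⁅y⁆∪⁅z⁆⇒∈ Fi≡
    in ⊥-elim (¬three-through t≢x (∈∧∉⇒≢ F s∈i s∉j) (∈∧∉⇒≢ F s∈i s∉k) j≢k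
                 (∈Through⁺ x∈i t∈i) (∈Through⁺ x∈j t∈j) (∈Through⁺ x∈k t∈k))

  module SinglyLinked {c y} (x∉c : x ∉ F c) (y∈c : y ∈ F c) (linkDeg[y]≡1 : linkDeg y ≡ 1) where

    record Petal (u v : Fin n) (j : Fin m) : Set where
      field
        x∈ : x ∈ F j
        y∉ : y ∉ F j
        u∈ : u ∈ F j
        v∉ : v ∉ F j

    open Petal

    Petals : Fin n → Fin n → Set
    Petals u v = ∃₂ λ j₁ j₂ → j₁ ≢ j₂ × Petal u v j₁ × Petal u v j₂

    2≤∣Avoiding[y]∩∁C∣ : v ∈ F c → 2 ≤ ∣ Avoiding y ∩ ∁ (containing F v) ∣
    2≤∣Avoiding[y]∩∁C∣ {v} v∈c = +-cancelˡ-≤ 3 2 _ (begin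
      5                                  ≤⟨ 5≤∣Link∣ ⟩
      ∣ Link ∣                           ≡⟨ ∣p∣≡∣p∩q∣+∣p∩∁q∣ Link (containing F y) ⟩
      linkDeg y + ∣ Avoiding y ∣         ≡⟨ cong₂ _+_ linkDeg[y]≡1 (∣p∣≡∣p∩q∣+∣p∩∁q∣ (Avoiding y) C) ⟩
      1 + (∣ Avoiding y ∩ C ∣ + ∣ Avoiding y ∩ ∁ C ∣)
                                         ≤⟨ +-monoʳ-≤ 1 (+-monoˡ-≤ _ (≤-trans ∣Avoiding[y]∩C∣≤linkDeg
                                              (linkDeg≤2 (x∈p∧y∉p⇒x≢y v∈c x∉c)))) ⟩
      3 + ∣ Avoiding y ∩ ∁ C ∣           ∎)
      where
      open ≤-Reasoning
      C = containing F v
      ∣Avoiding[y]∩C∣≤linkDeg : ∣ Avoiding y ∩ C ∣ ≤ linkDeg v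
      ∣Avoiding[y]∩C∣≤linkDeg = p⊆q⇒∣p∣≤∣q∣ λ j∈ →
        let (j∈A , j∈C) = x∈p∩q⁻ (Avoiding y) C j∈ in x∈p∩q⁺ (p∩q⊆p Link _ j∈A , j∈C)

    petals : F c ≡ ⁅ y ⁆ ∪ ⁅ u ⁆ ∪ ⁅ v ⁆ → Petals u v
    petals {u} {v} Fc≡ with ∃-pair (2≤∣Avoiding[y]∩∁C∣ (proj₂ (proj₂ (p≡⁅x⁆∪⁅y⁆∪⁅z⁆⇒∈ Fc≡))))
    ... | j₁ , j₂ , j₁≢j₂ , j₁∈ , j₂∈ = j₁ , j₂ , j₁≢j₂ , petal j₁∈ , petal j₂∈
      where
      petal : j ∈ Avoiding y ∩ ∁ (containing F v) → Petal u v j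
      petal j∈ with x∈p∩q⁻ (Avoiding y) _ j∈
      ... | j∈Avoiding , j∈∁C with ∈Avoiding⁻ j∈Avoiding
      ...   | x∈j , y∉j with link-meets-nonLink x∈j x∉c
      ...     | z , z∈ with x∈p∩q⁻ (F _) (F c) z∈
      ...       | z∈j , z∈c with ∈⁅x⁆∪⁅y⁆∪⁅z⁆⁻ (subst (z ∈_) Fc≡ z∈c)
      ...         | inj₁ refl        = ⊥-elim (y∉j z∈j)
      ...         | inj₂ (inj₁ refl) = record { x∈ = x∈j ; y∉ = y∉j ; u∈ = z∈j ; v∉ = v∉j }
        where v∉j = x∈∁p⇒x∉p j∈∁C ∘ ∈containing⁺ F
      ...         | inj₂ (inj₂ refl) = ⊥-elim (x∈∁p⇒x∉p j∈∁C (∈containing⁺ F z∈j))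

    -- i₀ is apart from j₁ and j₂; one of j₃, j₄ is apart from i₀, and it is apart from j₁ or j₂.
    ¬petals : ∀ {i₀ a u v j₁ j₂} → F i₀ ≡ ⁅ x ⁆ ∪ ⁅ y ⁆ ∪ ⁅ a ⁆ → a ≢ x →
              j₁ ≢ j₂ → Petal u v j₁ → Petal u v j₂ → a ∉ F j₁ → a ∉ F j₂ → Petals v u → ⊥
    ¬petals {i₀} {u = u} {v} Fi₀≡ a≢x j₁≢j₂ P₁ P₂ a∉j₁ a∉j₂ (_ , _ , j₃≢j₄ , P₃ , P₄) =
      Sum.[ ¬apartFrom-i₀ P₃ , ¬apartFrom-i₀ P₄ ] (¬Touch-one-of Fi₀≡ a≢x j₃≢j₄ (x∈ P₃) (x∈ P₄) (y∉ P₃) (y∉ P₄))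
      where
      x∈i₀ = proj₁ (p≡⁅x⁆∪⁅y⁆∪⁅z⁆⇒∈ Fi₀≡)
      ¬i₀j₁ = missing⇒¬Touch Fi₀≡ (y∉ P₁) a∉j₁
      ¬i₀j₂ = missing⇒¬Touch Fi₀≡ (y∉ P₂) a∉j₂
      ¬apartFrom-i₀ : ∀ {j} → Petal v u j → ¬ Touch i₀ j → ⊥
      ¬apartFrom-i₀ {j} Pj ¬i₀j with ∣p∣≡3⇒∃-completion (uniform j) (x∈ Pj) (u∈ Pj) (x∈p∧y∉p⇒x≢y (x∈ P₁) (v∉ P₁))
      ... | t , t≢x , _ , Fj≡ = Sum.[
            (λ ¬jj₁ → ¬pairwiseApart x∈i₀ (x∈ P₁) (x∈ Pj) ¬i₀j₁ ¬i₀j (¬Touch-sym ¬jj₁)) ,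
            (λ ¬jj₂ → ¬pairwiseApart x∈i₀ (x∈ P₂) (x∈ Pj) ¬i₀j₂ ¬i₀j (¬Touch-sym ¬jj₂)) ]
          (¬Touch-one-of Fj≡ t≢x j₁≢j₂ (x∈ P₁) (x∈ P₂) (v∉ P₁) (v∉ P₂))

    ∈petal⇒∉oppositePetal : ∀ {i₀ a j k u v} → F i₀ ≡ ⁅ x ⁆ ∪ ⁅ y ⁆ ∪ ⁅ a ⁆ → a ≢ x →
                            a ∈ F j → Petal u v j → Petal v u k → a ∉ F k
    ∈petal⇒∉oppositePetal Fi₀≡ a≢x a∈j Pj Pk a∈k =
      let (x∈i₀ , y∈i₀ , a∈i₀) = p≡⁅x⁆∪⁅y⁆∪⁅z⁆⇒∈ Fi₀≡
      in ¬three-through a≢x (∈∧∉⇒≢ F y∈i₀ (y∉ Pj)) (∈∧∉⇒≢ F y∈i₀ (y∉ Pk)) (≢-sym (∈∧∉⇒≢ F (u∈ Pk) (v∉ Pj)))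
           (∈Through⁺ x∈i₀ a∈i₀) (∈Through⁺ (x∈ Pj) a∈j) (∈Through⁺ (x∈ Pk) a∈k)

    -- a lies in at most one link set besides i₀, so it avoids both members of one of the pairs.
    ¬petalPairs : ∀ {i₀ a u v} → F i₀ ≡ ⁅ x ⁆ ∪ ⁅ y ⁆ ∪ ⁅ a ⁆ → a ≢ x → Petals u v → Petals v u → ⊥
    ¬petalPairs {a = a} Fi₀≡ a≢x A@(j₁ , j₂ , j₁≢j₂ , P₁ , P₂) B@(_ , _ , j₃≢j₄ , P₃ , P₄)
      with a ∈? F j₁ | a ∈? F j₂
    ... | no  a∉j₁ | no  a∉j₂ = ¬petals Fi₀≡ a≢x j₁≢j₂ P₁ P₂ a∉j₁ a∉j₂ B
    ... | yes a∈j₁ | _        = ¬petals Fi₀≡ a≢x j₃≢j₄ P₃ P₄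
      (∈petal⇒∉oppositePetal Fi₀≡ a≢x a∈j₁ P₁ P₃) (∈petal⇒∉oppositePetal Fi₀≡ a≢x a∈j₁ P₁ P₄) A
    ... | _        | yes a∈j₂ = ¬petals Fi₀≡ a≢x j₃≢j₄ P₃ P₄
      (∈petal⇒∉oppositePetal Fi₀≡ a≢x a∈j₂ P₂ P₃) (∈petal⇒∉oppositePetal Fi₀≡ a≢x a∈j₂ P₂ P₄) A

    impossible : ⊥
    impossible =
      let (u , u∈c , u≢y)        = ∃-other y∈c (2≤∣F∣ c)
          (v , _ , _ , Fc≡)      = ∣p∣≡3⇒∃-completion (uniform c) y∈c u∈c (≢-sym u≢y)
          (i₀ , i₀∈)             = nonempty {p = Through y} (≤-reflexive (sym linkDeg[y]≡1))
          (x∈i₀ , y∈i₀)          = ∈Through⁻ i₀∈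
          (a , a≢x , _ , Fi₀≡)   = ∣p∣≡3⇒∃-completion (uniform i₀) x∈i₀ y∈i₀ (≢-sym (x∈p∧y∉p⇒x≢y y∈c x∉c))
      in ¬petalPairs Fi₀≡ a≢x (petals Fc≡) (petals (trans Fc≡ (cong (⁅ y ⁆ ∪_) (∪-comm ⁅ u ⁆ ⁅ v ⁆))))

  ¬singlyLinked : ∀ {c y} → x ∉ F c → y ∈ F c → linkDeg y ≡ 1 → ⊥
  ¬singlyLinked x∉c y∈c linkDeg[y]≡1 = SinglyLinked.impossible x∉c y∈c linkDeg[y]≡1

  ∈∁Link⇒∉ : c ∈ ∁ Link → x ∉ F c
  ∈∁Link⇒∉ c∈ x∈c = x∈∁p⇒x∉p c∈ (∈containing⁺ F x∈c)

  nonLink≡c₀ : x ∉ F c → c ≡ c₀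
  nonLink≡c₀ {c} x∉c with c ≟ c₀
  ... | yes c≡c₀ = c≡c₀
  ... | no  c≢c₀ = ⊥-elim (¬evenComplement minimal Link (∈containing⁺ F x∈l₀) 2≤∣∁Link∣ even⊎full)
    where
    ∉⇒∈∁Link : ∀ {c} → x ∉ F c → c ∈ ∁ Link
    ∉⇒∈∁Link x∉c = x∉p⇒x∈∁p (x∉c ∘ ∈containing⁻ F)
    2≤∣∁Link∣ : 2 ≤ ∣ ∁ Link ∣
    2≤∣∁Link∣ = subst (_≤ ∣ ∁ Link ∣) (∣⁅x⁆∪⁅y⁆∣≡2 c≢c₀) (p⊆q⇒∣p∣≤∣q∣ (⁅x⁆∪⁅y⁆⊆p (∉⇒∈∁Link x∉c) (∉⇒∈∁Link x∉c₀)))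
    even⊎full : ∀ v → Even (linkDeg v) ⊎ linkDeg v ≡ deg F v
    even⊎full v with v ≟ x
    ... | yes refl = inj₂ (trans (degIn≡∣I∣ F (λ i∈ → i∈)) (sym (deg≡∣containing∣ F x)))
    ... | no  v≢x with ≤2⇒Even⊎≡1 (linkDeg≤2 v≢x)
    ...   | inj₁ even         = inj₁ even
    ...   | inj₂ linkDeg[v]≡1 = inj₂ (sym (begin
      deg F v                         ≡⟨ deg≡degIn+degIn∁ F Link v ⟩
      linkDeg v + degIn F (∁ Link) v  ≡⟨ cong (linkDeg v +_) (degIn≡0 F λ c∈ v∈c →
                                           ¬singlyLinked (∈∁Link⇒∉ c∈) v∈c linkDeg[v]≡1) ⟩
      linkDeg v + 0                   ≡⟨ +-identityʳ _ ⟩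
      linkDeg v                       ∎))
      where open ≡-Reasoning

  nonLinkDeg≤1 : ∀ v → degIn F (∁ Link) v ≤ 1
  nonLinkDeg≤1 v = degIn≤1 F λ i∈ j∈ _ _ → trans (nonLink≡c₀ (∈∁Link⇒∉ i∈)) (sym (nonLink≡c₀ (∈∁Link⇒∉ j∈)))

  nonLinkDeg≡0 : v ∉ F c₀ → degIn F (∁ Link) v ≡ 0
  nonLinkDeg≡0 {v} v∉c₀ = degIn≡0 F λ c∈ v∈c →
    v∉c₀ (subst (λ c → v ∈ F c) (nonLink≡c₀ (∈∁Link⇒∉ c∈)) v∈c)

  deg≤3 : v ≢ x → deg F v ≤ 3
  deg≤3 {v} v≢x = subst (_≤ 3) (sym (deg≡degIn+degIn∁ F Link v)) (+-mono-≤ (linkDeg≤2 v≢x) (nonLinkDeg≤1 v))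

  deg≤1 : v ≢ x → v ∉ F c₀ → deg F v ≤ 1
  deg≤1 {v} v≢x v∉c₀ = ≤2∧0⊎Odd⇒≤1 (subst (_≤ 2) (sym deg≡linkDeg) (linkDeg≤2 v≢x)) (deg≡0⊎Odd minimal v)
    where
    deg≡linkDeg : deg F v ≡ linkDeg v
    deg≡linkDeg = trans (deg≡degIn+degIn∁ F Link v) (trans (cong (linkDeg v +_) (nonLinkDeg≡0 v∉c₀)) (+-identityʳ _))

  2≤∣∁J∣ : ∀ J → ∣ J ∣ ≤ 3 → 2 ≤ ∣ ∁ J ∣
  2≤∣∁J∣ J ∣J∣≤3 = subst (2 ≤_) (sym (∣∁p∣≡n∸∣p∣ J)) (∸-mono (≤-trans 5≤∣Link∣ (∣p∣≤n Link)) ∣J∣≤3)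

  ¬agreeing : j ≢ k → x ∈ F j → x ∈ F k →
              (∀ {z} → z ∈ F c₀ → (z ∈ F j × z ∈ F k) ⊎ (z ∉ F j × z ∉ F k)) → ⊥
  ¬agreeing {j} {k} j≢k x∈j x∈k agree =
    ¬evenComplement minimal J x∈⁅x⁆∪p (2≤∣∁J∣ J (≤-trans (≤-reflexive ∣J∣≡2) (n≤1+n 2))) even⊎full
    where
    J = ⁅ j ⁆ ∪ ⁅ k ⁆
    ∣J∣≡2 = ∣⁅x⁆∪⁅y⁆∣≡2 j≢k
    both : v ∈ F j → v ∈ F k → Even (degIn F J v)
    both v∈j v∈k = subst Even (sym (trans
      (degIn≡∣I∣ F (⁅x⁆∪⁅y⁆⊆p (∈containing⁺ F v∈j) (∈containing⁺ F v∈k))) ∣J∣≡2)) refl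
    neither : v ∉ F j → v ∉ F k → Even (degIn F J v)
    neither v∉j v∉k = subst Even (sym (degIn≡0 F {I = J} λ p∈ →
      Sum.[ (λ { refl → v∉j }) , (λ { refl → v∉k }) ] (∈⁅x⁆∪⁅y⁆⁻ p∈))) refl
    even⊎full : ∀ v → Even (degIn F J v) ⊎ degIn F J v ≡ deg F v
    even⊎full v with v ≟ x | v ∈? F c₀
    ... | yes refl | _        = inj₁ (both x∈j x∈k)
    ... | no  _    | yes v∈c₀ = inj₁ (Sum.[ uncurry both , uncurry neither ] (agree v∈c₀))
    ... | no  v≢x  | no  v∉c₀ = ≤∧≤1⇒Even⊎≡ (degIn≤deg F J v) (deg≤1 v≢x v∉c₀)

  ¬covering : j ≢ k → x ∈ F j → x ∈ F k → (∀ {z} → z ∈ F c₀ → z ∈ F j ⊎ z ∈ F k) → ⊥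
  ¬covering {j} {k} j≢k x∈j x∈k cover =
    ¬evenComplement minimal J x∈⁅x⁆∪p (2≤∣∁J∣ J (≤-reflexive ∣J∣≡3)) even⊎full
    where
    J = ⁅ c₀ ⁆ ∪ ⁅ j ⁆ ∪ ⁅ k ⁆
    c₀≢j = ≢-sym (∈∧∉⇒≢ F x∈j x∉c₀)
    c₀≢k = ≢-sym (∈∧∉⇒≢ F x∈k x∉c₀)
    ∣J∣≡3 = ∣⁅x⁆∪⁅y⁆∪⁅z⁆∣≡3 c₀≢j c₀≢k j≢k
    degIn[J]x≡2 : degIn F J x ≡ 2
    degIn[J]x≡2 = trans (degIn-⁅i⁆∪-∉ F x∉c₀)
      (trans (degIn≡∣I∣ F (⁅x⁆∪⁅y⁆⊆p (∈containing⁺ F x∈j) (∈containing⁺ F x∈k))) (∣⁅x⁆∪⁅y⁆∣≡2 j≢k))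
    2≤degIn : ∀ {v p} → p ∈ J → c₀ ≢ p → v ∈ F c₀ → v ∈ F p → 2 ≤ degIn F J v
    2≤degIn p∈J c₀≢p v∈c₀ v∈p = subst (_≤ _) (∣⁅x⁆∪⁅y⁆∣≡2 c₀≢p)
      (∣K∣≤degIn F (⁅x⁆∪⁅y⁆⊆p x∈⁅x⁆∪p p∈J) (⁅x⁆∪⁅y⁆⊆p (∈containing⁺ F v∈c₀) (∈containing⁺ F v∈p)))
    even⊎full : ∀ v → Even (degIn F J v) ⊎ degIn F J v ≡ deg F v
    even⊎full v with v ≟ x | v ∈? F c₀
    ... | yes refl | _        = inj₁ (subst Even (sym degIn[J]x≡2) refl)
    ... | no  v≢x  | yes v∈c₀ = 2≤∧≤∧≤3⇒Even⊎≡
      (Sum.[ 2≤degIn y∈⁅x⁆∪⁅y⁆∪⁅z⁆ c₀≢j v∈c₀ , 2≤degIn z∈⁅x⁆∪⁅y⁆∪⁅z⁆ c₀≢k v∈c₀ ] (cover v∈c₀))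
      (degIn≤deg F J v) (deg≤3 v≢x)
    ... | no  v≢x  | no  v∉c₀ = ≤∧≤1⇒Even⊎≡ (degIn≤deg F J v) (deg≤1 v≢x v∉c₀)

  3≤∣Avoiding∣ : w ≢ x → 3 ≤ ∣ Avoiding w ∣
  3≤∣Avoiding∣ {w} w≢x = +-cancelˡ-≤ 2 3 _ (begin
    5                           ≤⟨ 5≤∣Link∣ ⟩
    ∣ Link ∣                    ≡⟨ ∣p∣≡∣p∩q∣+∣p∩∁q∣ Link (containing F w) ⟩
    linkDeg w + ∣ Avoiding w ∣  ≤⟨ +-monoˡ-≤ _ (linkDeg≤2 w≢x) ⟩
    2 + ∣ Avoiding w ∣          ∎)
    where open ≤-Reasoning

  Only : Fin n → Fin n → Fin m → Set
  Only u v i = u ∈ F i × v ∉ F i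

  ¬sameSide : F c₀ ≡ ⁅ w ⁆ ∪ ⁅ u ⁆ ∪ ⁅ v ⁆ → i ≢ j → i ∈ Avoiding w → j ∈ Avoiding w →
              Only u v i → Only u v j → ⊥
  ¬sameSide {i = i} {j} Fc₀≡ i≢j i∈ j∈ (u∈i , v∉i) (u∈j , v∉j) =
    ¬agreeing i≢j x∈i x∈j agree
    where
    x∈i = proj₁ (∈Avoiding⁻ i∈)
    x∈j = proj₁ (∈Avoiding⁻ j∈)
    agree : ∀ {z} → z ∈ F c₀ → (z ∈ F i × z ∈ F j) ⊎ (z ∉ F i × z ∉ F j)
    agree {z} z∈c₀ with ∈⁅x⁆∪⁅y⁆∪⁅z⁆⁻ (subst (z ∈_) Fc₀≡ z∈c₀)
    ... | inj₁ refl        = inj₂ (proj₂ (∈Avoiding⁻ i∈) , proj₂ (∈Avoiding⁻ j∈))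
    ... | inj₂ (inj₁ refl) = inj₁ (u∈i , u∈j)
    ... | inj₂ (inj₂ refl) = inj₂ (v∉i , v∉j)

  only⊎only : F c₀ ≡ ⁅ w ⁆ ∪ ⁅ u ⁆ ∪ ⁅ v ⁆ → w ∈ F l₀ → i ∈ Avoiding w → Only u v i ⊎ Only v u i
  only⊎only {w} {u} {v} {i} Fc₀≡ w∈l₀ i∈ with ∈Avoiding⁻ i∈ | u ∈? F i | v ∈? F i
  ... | _         | yes u∈i | no  v∉i = inj₁ (u∈i , v∉i)
  ... | _         | no  u∉i | yes v∈i = inj₂ (v∈i , u∉i)
  ... | x∈i , w∉i | yes u∈i | yes v∈i = ⊥-elim (¬covering (∈∧∉⇒≢ F w∈l₀ w∉i) x∈l₀ x∈i cover)
    where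
    cover : ∀ {z} → z ∈ F c₀ → z ∈ F l₀ ⊎ z ∈ F i
    cover {z} z∈c₀ with ∈⁅x⁆∪⁅y⁆∪⁅z⁆⁻ (subst (z ∈_) Fc₀≡ z∈c₀)
    ... | inj₁ refl        = inj₁ w∈l₀
    ... | inj₂ (inj₁ refl) = inj₂ u∈i
    ... | inj₂ (inj₂ refl) = inj₂ v∈i
  ... | x∈i , w∉i | no  u∉i | no  v∉i with link-meets-nonLink x∈i x∉c₀
  ...   | z , z∈ with x∈p∩q⁻ (F i) (F c₀) z∈
  ...     | z∈i , z∈c₀ with ∈⁅x⁆∪⁅y⁆∪⁅z⁆⁻ (subst (z ∈_) Fc₀≡ z∈c₀)
  ...       | inj₁ refl        = ⊥-elim (w∉i z∈i)
  ...       | inj₂ (inj₁ refl) = ⊥-elim (u∉i z∈i)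
  ...       | inj₂ (inj₂ refl) = ⊥-elim (v∉i z∈i)

  ¬threeAvoiding : F c₀ ≡ ⁅ w ⁆ ∪ ⁅ u ⁆ ∪ ⁅ v ⁆ → w ∈ F l₀ → i ≢ j → i ≢ k → j ≢ k →
                   i ∈ Avoiding w → j ∈ Avoiding w → k ∈ Avoiding w → ⊥
  ¬threeAvoiding {w} {u} {v} {i} {j} {k} Fc₀≡ w∈l₀ i≢j i≢k j≢k i∈ j∈ k∈ =
    pigeonhole (only⊎only Fc₀≡ w∈l₀ i∈) (only⊎only Fc₀≡ w∈l₀ j∈) (only⊎only Fc₀≡ w∈l₀ k∈)
    where
    Fc₀≡′ = trans Fc₀≡ (cong (⁅ w ⁆ ∪_) (∪-comm ⁅ u ⁆ ⁅ v ⁆))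
    pigeonhole : Only u v i ⊎ Only v u i → Only u v j ⊎ Only v u j → Only u v k ⊎ Only v u k → ⊥
    pigeonhole (inj₁ oi) (inj₁ oj) _         = ¬sameSide Fc₀≡  i≢j i∈ j∈ oi oj
    pigeonhole (inj₁ oi) (inj₂ _)  (inj₁ ok) = ¬sameSide Fc₀≡  i≢k i∈ k∈ oi ok
    pigeonhole (inj₁ _)  (inj₂ oj) (inj₂ ok) = ¬sameSide Fc₀≡′ j≢k j∈ k∈ oj ok
    pigeonhole (inj₂ _)  (inj₁ oj) (inj₁ ok) = ¬sameSide Fc₀≡  j≢k j∈ k∈ oj ok
    pigeonhole (inj₂ oi) (inj₁ _)  (inj₂ ok) = ¬sameSide Fc₀≡′ i≢k i∈ k∈ oi ok
    pigeonhole (inj₂ oi) (inj₂ oj) _         = ¬sameSide Fc₀≡′ i≢j i∈ j∈ oi oj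

  impossible : ⊥
  impossible =
    let (c₁ , c₁∈)            = link-meets-nonLink x∈l₀ x∉c₀
        (c₁∈l₀ , c₁∈c₀)       = x∈p∩q⁻ (F l₀) (F c₀) c₁∈
        (c₂ , c₂∈c₀ , c₂≢c₁)  = ∃-other c₁∈c₀ (2≤∣F∣ c₀)
        (_ , _ , _ , Fc₀≡)    = ∣p∣≡3⇒∃-completion (uniform c₀) c₁∈c₀ c₂∈c₀ (≢-sym c₂≢c₁)
        (_ , _ , _ , i≢j , i≢k , j≢k , i∈ , j∈ , k∈) = ∃-triple (3≤∣Avoiding∣ (x∈p∧y∉p⇒x≢y c₁∈c₀ x∉c₀))
    in ¬threeAvoiding Fc₀≡ c₁∈l₀ i≢j i≢k j≢k i∈ j∈ k∈

lemma9 : ∀ {m n} (F : Fin m → Subset n) → Injective _≡_ _≡_ F →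
    Uniform 3 F → IsMinimalOddSunflower F →
    ((x : Fin n) → ∃ λ i → x ∉ F i) →
    (x : Fin n) → 2 ≤ deg F x → deg F x ≡ 3
lemma9 F injective uniform minimal noKernel x 2≤deg with 5 ≤? deg F x
... | yes 5≤deg = ⊥-elim (DegreeAtLeastFive.impossible F injective uniform minimal noKernel x 5≤deg)
... | no  5≰deg = 2≤∧<5∧0⊎Odd⇒≡3 2≤deg (≰⇒> 5≰deg) (deg≡0⊎Odd minimal x)
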